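{- The class of dichotomic graphs is $\le_{\mathrm{BF}}$-complete for $\mathsf{G}\,\mathrm{FO}(=)$, i.e. it belongs to $\mathsf{G}\,\mathrm{FO}(=)$ and every graph class in $\mathsf{G}\,\mathrm{FO}(=)$ is $\le_{\mathrm{BF}}$-reducible to it.
   Context: Graphs are finite directed graphs (possibly with self-loops); a graph class is a set of finite graphs closed under isomorphism. A directed graph $G$ is dichotomic if for all $u,v\in V(G)$ and $\alpha\in\{\mathrm{in},\mathrm{out}\}$, either $N_\alpha(u)\cap N_\alpha(v)=\emptyset$ or $N_\alpha(u)=N_\alpha(v)$, where $N_{\mathrm{in}},N_{\mathrm{out}}$ denote in- and out-neighbourhoods. For $n\ge1$, $\mathcal{N}_n$ is the structure with universe $\{0,\dots,n\}$. $\mathrm{FO}_{k}(=)$ denotes first-order formulas with $k$ free variables using only equality (no further relation or function symbols). A logical labeling scheme is $(\varphi,c)$ with $\varphi\in\mathrm{FO}_{2k}(=)$, $c,k\in\mathbb{N}$; a graph $G$ with $n$ vertices is in $\mathrm{gr}(\varphi,c)$ if there is $\ell\colon V(G)\to\{0,\dots,n^c\}^k$ with $(u,v)\in E(G)\iff\mathcal{N}_{n^c},(\ell(u),\ell(v))\models\varphi$ for all $u,v$. $\mathsf{G}\,\mathrm{FO}(=)$ is the set of graph classes $\mathcal{C}$ with $\mathcal{C}\subseteq\mathrm{gr}(\varphi,c)$ for some such $(\varphi,c)$. For a $k$-ary boolean function $f$ and graph classes $\mathcal{C}_1,\dots,\mathcal{C}_k$, $f(\mathcal{C}_1,\dots,\mathcal{C}_k)$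 is the class of graphs $G$ for which there are $H_i\in\mathcal{C}_i$, all on the vertex set $V$ of $G$, with $(u,v)\in E(G)\iff f(x_1,\dots,x_k)=1$, $x_i=1$ iff $(u,v)\in E(H_i)$, for all distinct $u,v\in V$. $\mathcal{C}\le_{\mathrm{BF}}\mathcal{D}$ if $\mathcal{C}\subseteq f(\mathcal{D},\dots,\mathcal{D})$ for some boolean function $f$. -}

module Defs where

open import Data.Nat using (ℕ; suc; _+_; _^_)
open import Data.Fin using (Fin; _≟_)
open import Data.Bool using (Bool; true; false; _∧_)
open import Data.Product using (Σ; _×_; _,_; ∃; ∃-syntax)
open import Data.Sum using (_⊎_)
open import Data.Empty using (⊥)
open import Relation.Nullary using (¬_)
open import Relation.Binary.PropositionalEquality using (_≡_)
open import Function.Bundles using (_↔_; Inverse)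
open import Function.Bundles using (_⇔_)
open import Data.Vec.Functional using (Vector; _++_; _∷_)

record Graph : Set where
  constructor mkGraph
  field
    size : ℕ
    E    : Fin size → Fin size → Bool
open Graph public

_≅_ : Graph → Graph → Set
G ≅ H = Σ (Fin (size G) ↔ Fin (size H)) λ π →
          ∀ u v → E H (Inverse.to π u) (Inverse.to π v) ≡ E G u v

Class : Set₁
Class = Graph → Set

IsoClosed : Class → Set
IsoClosed C = ∀ G H → G ≅ H → C G → C H

data Dir : Set where
  inn out : Dir

Nbr : (G : Graph) → Dir → Fin (size G) → Fin (size G) → Bool
Nbr G inn w x = E G w x
Nbr G out w x = E G x w

Dichotomic : Class
Dichotomic G = ∀ (u v : Fin (size G)) (α : Dir) →
  (∀ w → ¬ (Nbr G α w u ≡ true × Nbr G α w v ≡ true))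
  ⊎ (∀ w → Nbr G α w u ≡ Nbr G α w v)

-- First-order formulas over the empty signature with equality,
-- with free variables among Fin m (de Bruijn style).

data Formula : ℕ → Set where
  _≐_  : ∀ {m} → Fin m → Fin m → Formula m
  ¬'_  : ∀ {m} → Formula m → Formula m
  _∧'_ : ∀ {m} → Formula m → Formula m → Formula m
  _∨'_ : ∀ {m} → Formula m → Formula m → Formula m
  ∃'_  : ∀ {m} → Formula (suc m) → Formula m
  ∀'_  : ∀ {m} → Formula (suc m) → Formula m

-- Satisfaction in 𝒩_N, the pure set with universe {0,…,N} = Fin (suc N).
Sat : (N : ℕ) → ∀ {m} → Formula m → (Fin m → Fin (suc N)) → Set
Sat N (i ≐ j)   ρ = ρ i ≡ ρ j
Sat N (¬' φ)    ρ = ¬ Sat N φ ρ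
Sat N (φ ∧' ψ)  ρ = Sat N φ ρ × Sat N ψ ρ
Sat N (φ ∨' ψ)  ρ = Sat N φ ρ ⊎ Sat N ψ ρ
Sat N (∃' φ)    ρ = Σ (Fin (suc N)) λ a → Sat N φ (a ∷ ρ)
Sat N (∀' φ)    ρ = ∀ (a : Fin (suc N)) → Sat N φ (a ∷ ρ)

gr : (k : ℕ) → Formula (k + k) → ℕ → Class
gr k φ c G =
  Σ (Fin (size G) → Vector (Fin (suc (size G ^ c))) k) λ ℓ →
    ∀ (u v : Fin (size G)) →
      (E G u v ≡ true) ⇔ Sat (size G ^ c) φ (_++_ {m = k} {n = k} (ℓ u) (ℓ v))

GFO : Class → Set
GFO C = Σ ℕ λ k → Σ (Formula (k + k)) λ φ → Σ ℕ λ c → (∀ G → C G → gr k φ c G)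

BoolFun : ℕ → Set
BoolFun k = (Fin k → Bool) → Bool

BFComb : (k : ℕ) → BoolFun k → Class → Class
BFComb k f D G =
  Σ (Fin k → Fin (size G) → Fin (size G) → Bool) λ H → ((∀ (i : Fin k) → D (mkGraph (size G) (H i)))
         × (∀ (u v : Fin (size G)) → ¬ (u ≡ v) →
              E G u v ≡ f (λ i → H i u v)))

_≤BF_ : Class → Class → Set
C ≤BF D = Σ ℕ λ k → Σ (BoolFun k) λ f → (∀ G → C G → BFComb k f D G)

{-# OPTIONS --safe #-}
-- Out-neighbourhoods in a dichotomic graph are pairwise equal or disjoint, so
-- u → v is an edge iff the first out-neighbour of u equals the first
-- out-neighbour of the first in-neighbour of v; with these two vertices and a
-- constant for "none" as labels, one equality test decides adjacency.
--
-- Conversely, satisfaction in a pure set is invariant under equality types, so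
-- if E(u,v) is φ(ℓ u, ℓ v) it depends only on the (2k)² equality bits between
-- entries of ℓ u and ℓ v. Each bit compares a function of u with a function of
-- v, so it is a dichotomic graph; a further 2^((2k)²) constant (hence
-- dichotomic) graphs record which equality types occur on edges, and the
-- boolean function looks up the bit of the observed equality type.
module Submission where

open import Defs
open import Data.Nat using (ℕ; zero; suc; _+_; _*_; _^_)
open import Data.Nat.Properties using (^-identityʳ; 1+n≰n)
open import Data.Fin using (Fin; zero; suc; splitAt; _↑ˡ_; _↑ʳ_; combine; remQuot; punchOut; funToFin; finToFun; _≟_)
open import Data.Fin.Patterns using (0F; 2F; 4F)
open import Data.Fin.Properties
  using (suc-injective; any?; all?; ¬∀⟶∃¬; injective⇒≤; punchOut-injective;
         splitAt-↑ˡ; splitAt-↑ʳ; remQuot-combine; finToFun-funToFin; 2↔Bool)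
open import Data.Bool as Bool using (Bool; true; false; if_then_else_)
open import Data.Bool.Properties using (⇔→≡)
open import Data.Maybe as Maybe using (Maybe; just; nothing; _>>=_)
open import Data.Product using (Σ; ∃-syntax; _×_; _,_; proj₁; proj₂)
open import Data.Sum using (_⊎_; inj₁; inj₂; [_,_]′)
open import Data.Vec.Functional using (Vector; _++_; _∷_; [])
open import Function using (_∘_; const; flip)
open import Function.Bundles using (_⇔_; mk⇔; Equivalence; Inverse)
import Function.Properties.Equivalence as ⇔
open import Relation.Binary.Definitions using (DecidableEquality)
open import Relation.Binary.PropositionalEquality
open import Relation.Nullary using (¬_; Dec; yes; no; does; contradiction)
open import Relation.Nullary.Decidable using (dec-true; decidable-stable; _×-dec_; ¬?)

private
  variable
    A B : Set
    m n : ℕ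

open Equivalence using (to; from)

does≡true⇔ : (a? : Dec A) → does a? ≡ true ⇔ A
does≡true⇔ (yes a) = mk⇔ (const a) (const refl)
does≡true⇔ (no ¬a) = mk⇔ (λ ()) (λ a → contradiction a ¬a)

does-≡⇒⇔ : (a? : Dec A) (b? : Dec B) → does a? ≡ does b? → A ⇔ B
does-≡⇒⇔ (yes a) (yes b) _ = mk⇔ (const b) (const a)
does-≡⇒⇔ (no ¬a) (no ¬b) _ = mk⇔ (λ a → contradiction a ¬a) (λ b → contradiction b ¬b)

first : (Fin n → Bool) → Maybe (Fin n)
first {zero}  p = nothing
first {suc n} p = if p zero then just zero else Maybe.map suc (first (p ∘ suc))

first-sound : (p : Fin n → Bool) {w : Fin n} → first p ≡ just w → p w ≡ true
first-sound {suc n} p eq with p zero in p₀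
first-sound {suc n} p refl | true = p₀
first-sound {suc n} p eq   | false with first (p ∘ suc) in e
first-sound {suc n} p refl | false | just w = first-sound (p ∘ suc) e

first-complete : (p : Fin n → Bool) {w : Fin n} → p w ≡ true → ∃[ w′ ] first p ≡ just w′
first-complete {suc n} p {w} pw with p zero in p₀
... | true = zero , refl
first-complete {suc n} p {zero}  pw | false = contradiction (trans (sym p₀) pw) λ ()
first-complete {suc n} p {suc w} pw | false =
  let w′ , e = first-complete (p ∘ suc) pw in suc w′ , cong (Maybe.map suc) e

first-cong : {p q : Fin n → Bool} → (∀ w → p w ≡ q w) → first p ≡ first q
first-cong {zero}          p≗q = refl
first-cong {suc n} {p} {q} p≗q rewrite p≗q zero with q zero
... | true  = refl
... | false = cong (Maybe.map suc) (first-cong (p≗q ∘ suc))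

matching⇒dichotomic : DecidableEquality A → (G : Graph) (g h : Fin (size G) → A) →
                      (∀ u v → E G u v ≡ true ⇔ g u ≡ h v) → Dichotomic G
matching⇒dichotomic _≟A_ G g h match u v out with g u ≟A g v
... | yes gu≡gv = inj₂ λ w → ⇔→≡ (⇔.trans (match u w)
                                     (⇔.trans (mk⇔ (trans (sym gu≡gv)) (trans gu≡gv)) (⇔.sym (match v w))))
... | no  gu≢gv = inj₁ λ w (uw , vw) → gu≢gv (trans (to (match u w) uw) (sym (to (match v w) vw)))
matching⇒dichotomic _≟A_ G g h match u v inn with h u ≟A h v
... | yes hu≡hv = inj₂ λ w → ⇔→≡ (⇔.trans (match w u)
                                     (⇔.trans (mk⇔ (flip trans hu≡hv) (flip trans (sym hu≡hv))) (⇔.sym (match w v))))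
... | no  hu≢hv = inj₁ λ w (wu , wv) → hu≢hv (trans (sym (to (match w u) wu)) (to (match w v) wv))

constant-dichotomic : (n : ℕ) (b : Bool) → Dichotomic (mkGraph n λ _ _ → b)
constant-dichotomic n b =
  matching⇒dichotomic Bool._≟_ (mkGraph n λ _ _ → b) (const b) (const true) (λ _ _ → ⇔.refl)

shared-out-neighbour⇒same-out : (G : Graph) → Dichotomic G → ∀ {u u′ w} →
                                E G u w ≡ true → E G u′ w ≡ true → ∀ x → E G u x ≡ E G u′ x
shared-out-neighbour⇒same-out G dich {u} {u′} {w} uw u′w with dich u u′ out
... | inj₁ disjoint = contradiction (uw , u′w) (disjoint w)
... | inj₂ same     = same

-- gr k φ c G unfolds to Represents (size G ^ c) k φ G.
Represents : (N k : ℕ) → Formula (k + k) → Graph → Set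
Represents N k φ G =
  Σ (Fin (size G) → Vector (Fin (suc N)) k) λ ℓ → ∀ u v →
    (E G u v ≡ true) ⇔ Sat N φ (_++_ {m = k} {n = k} (ℓ u) (ℓ v))

toFin : Maybe (Fin n) → Fin (suc n)
toFin nothing  = zero
toFin (just w) = suc w

toFin-agree⇔ : (x y : Maybe (Fin n)) →
               (toFin x ≡ toFin y × toFin x ≢ zero) ⇔ (∃[ w ] (x ≡ just w × y ≡ just w))
toFin-agree⇔ nothing  y        = mk⇔ (λ (_ , x≢0) → contradiction refl x≢0) λ ()
toFin-agree⇔ (just a) nothing  = mk⇔ (λ ()) λ ()
toFin-agree⇔ (just a) (just b) =
  mk⇔ (λ (eq , _) → a , refl , cong just (sym (suc-injective eq))) λ { (w , refl , refl) → refl , λ () }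

>>=-just : (x : Maybe A) (f : A → Maybe B) {b : B} → (x >>= f) ≡ just b → ∃[ a ] (x ≡ just a × f a ≡ just b)
>>=-just (just a) f eq = a , refl , eq

-- Variables 0F–2F are the labels of the source, 3F–5F those of the target;
-- the third label of every vertex is the constant toFin nothing.
reps-agree : Formula (3 + 3)
reps-agree = (0F ≐ 4F) ∧' (¬' (0F ≐ 2F))

module DichotomicLabels (G : Graph) (dich : Dichotomic G) where

  outRep : Fin (size G) → Maybe (Fin (size G))
  outRep u = first (E G u)

  inRep : Fin (size G) → Maybe (Fin (size G))
  inRep v = first λ u → E G u v

  matchRep : Fin (size G) → Maybe (Fin (size G))
  matchRep v = inRep v >>= outRep

  edge⇔reps-agree : ∀ u v → E G u v ≡ true ⇔ (∃[ w ] (outRep u ≡ just w × matchRep v ≡ just w))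
  edge⇔reps-agree u v = mk⇔ edge⇒agree agree⇒edge
    where
    edge⇒agree : E G u v ≡ true → ∃[ w ] (outRep u ≡ just w × matchRep v ≡ just w)
    edge⇒agree uv =
      let w  , out-u = first-complete (E G u) uv
          u₀ , in-v  = first-complete (λ x → E G x v) uv
          u₀v        = first-sound (λ x → E G x v) in-v
          out-u₀     = first-cong (shared-out-neighbour⇒same-out G dich u₀v uv)
      in w , out-u , trans (cong (_>>= outRep) in-v) (trans out-u₀ out-u)

    agree⇒edge : ∃[ w ] (outRep u ≡ just w × matchRep v ≡ just w) → E G u v ≡ true
    agree⇒edge (w , out-u , match-v) =
      let u₀ , in-v , out-u₀ = >>=-just (inRep v) outRep match-v
          u₀v = first-sound (λ x → E G x v) in-v
          uw  = first-sound (E G u) out-u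
          u₀w = first-sound (E G u₀) out-u₀
      in trans (shared-out-neighbour⇒same-out G dich uw u₀w v) u₀v

  represents : Represents (size G) 3 reps-agree G
  represents = label , λ u v → ⇔.trans (edge⇔reps-agree u v) (⇔.sym (toFin-agree⇔ (outRep u) (matchRep v)))
    where
    label : Fin (size G) → Vector (Fin (suc (size G))) 3
    label w = toFin (outRep w) ∷ toFin (matchRep w) ∷ toFin nothing ∷ []

dichotomic∈GFO : GFO Dichotomic
dichotomic∈GFO = 3 , reps-agree , 1 , λ G dich →
  subst (λ N → Represents N 3 reps-agree G) (sym (^-identityʳ (size G))) (DichotomicLabels.represents G dich)

_≈_ : (ρ ρ′ : Fin m → A) → Set
ρ ≈ ρ′ = ∀ i j → ρ i ≡ ρ j ⇔ ρ′ i ≡ ρ′ j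

≈-sym : {ρ ρ′ : Fin m → A} → ρ ≈ ρ′ → ρ′ ≈ ρ
≈-sym ρ≈ρ′ i j = ⇔.sym (ρ≈ρ′ i j)

Avoids : A → (Fin m → A) → Set
Avoids x ρ = ∀ j → ρ j ≢ x

surjective⊎avoided : (ρ : Fin m → Fin n) → (∀ y → ∃[ j ] ρ j ≡ y) ⊎ (∃[ y ] Avoids y ρ)
surjective⊎avoided {m} ρ with any? (λ y → all? λ j → ¬? (ρ j ≟ y))
... | yes avoided = inj₂ avoided
... | no ¬avoided = inj₁ λ y →
  let j , ¬¬ρj≡y = ¬∀⟶∃¬ m (λ j → ρ j ≢ y) (λ j → ¬? (ρ j ≟ y)) (λ avoids → ¬avoided (y , avoids))
  in j , decidable-stable (ρ j ≟ y) ¬¬ρj≡y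

-- If ρ′ were onto, y ↦ ρ (preimage y) would inject the N + 1 points into the
-- N points other than x.
avoided-transfer : {N : ℕ} {ρ ρ′ : Fin m → Fin (suc N)} → ρ ≈ ρ′ →
                   ∃[ x ] Avoids x ρ → ∃[ x′ ] Avoids x′ ρ′
avoided-transfer {m} {N} {ρ} {ρ′} ρ≈ρ′ (x , x∉ρ) with surjective⊎avoided ρ′
... | inj₂ avoided = avoided
... | inj₁ onto    = contradiction (injective⇒≤ squeeze-injective) 1+n≰n
  where
  preimage : Fin (suc N) → Fin m
  preimage y = proj₁ (onto y)

  squeeze : Fin (suc N) → Fin N
  squeeze y = punchOut (x∉ρ (preimage y) ∘ sym)

  squeeze-injective : ∀ {y z} → squeeze y ≡ squeeze z → y ≡ z
  squeeze-injective {y} {z} eq = begin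
    y                ≡⟨ sym (proj₂ (onto y)) ⟩
    ρ′ (preimage y)  ≡⟨ to (ρ≈ρ′ (preimage y) (preimage z)) (punchOut-injective {i = x} _ _ eq) ⟩
    ρ′ (preimage z)  ≡⟨ proj₂ (onto z) ⟩
    z                ∎
    where open ≡-Reasoning

∷-≈ : {ρ ρ′ : Fin m → A} {x x′ : A} →
      ρ ≈ ρ′ → (∀ j → x ≡ ρ j ⇔ x′ ≡ ρ′ j) → (x ∷ ρ) ≈ (x′ ∷ ρ′)
∷-≈ ρ≈ρ′ x~x′ zero    zero    = mk⇔ (const refl) (const refl)
∷-≈ ρ≈ρ′ x~x′ zero    (suc j) = x~x′ j
∷-≈ ρ≈ρ′ x~x′ (suc i) zero    = mk⇔ (sym ∘ to (x~x′ i) ∘ sym) (sym ∘ from (x~x′ i) ∘ sym)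
∷-≈ ρ≈ρ′ x~x′ (suc i) (suc j) = ρ≈ρ′ i j

extend-≈ : {N : ℕ} {ρ ρ′ : Fin m → Fin (suc N)} → ρ ≈ ρ′ →
           (x : Fin (suc N)) → ∃[ x′ ] (x ∷ ρ) ≈ (x′ ∷ ρ′)
extend-≈ {ρ = ρ} {ρ′} ρ≈ρ′ x with any? (λ i → ρ i ≟ x)
... | yes (i , refl) = ρ′ i , ∷-≈ ρ≈ρ′ (ρ≈ρ′ i)
... | no  x∉ρ       =
  let x′ , x′∉ρ′ = avoided-transfer ρ≈ρ′ (x , λ j ρj≡x → x∉ρ (j , ρj≡x))
  in x′ , ∷-≈ ρ≈ρ′ λ j → mk⇔ (λ x≡ρj → contradiction (j , sym x≡ρj) x∉ρ)
                              (λ x′≡ρ′j → contradiction (sym x′≡ρ′j) (x′∉ρ′ j))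

Sat-resp-≈ : {N : ℕ} (φ : Formula m) {ρ ρ′ : Fin m → Fin (suc N)} → ρ ≈ ρ′ → Sat N φ ρ → Sat N φ ρ′
Sat-resp-≈ (i ≐ j)  ρ≈ρ′ sat           = to (ρ≈ρ′ i j) sat
Sat-resp-≈ (¬' φ)   ρ≈ρ′ ¬sat          = ¬sat ∘ Sat-resp-≈ φ (≈-sym ρ≈ρ′)
Sat-resp-≈ (φ ∧' ψ) ρ≈ρ′ (satφ , satψ) = Sat-resp-≈ φ ρ≈ρ′ satφ , Sat-resp-≈ ψ ρ≈ρ′ satψ
Sat-resp-≈ (φ ∨' ψ) ρ≈ρ′ (inj₁ satφ)   = inj₁ (Sat-resp-≈ φ ρ≈ρ′ satφ)
Sat-resp-≈ (φ ∨' ψ) ρ≈ρ′ (inj₂ satψ)   = inj₂ (Sat-resp-≈ ψ ρ≈ρ′ satψ)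
Sat-resp-≈ (∃' φ)   ρ≈ρ′ (x , sat)     =
  let x′ , ≈′ = extend-≈ ρ≈ρ′ x in x′ , Sat-resp-≈ φ ≈′ sat
Sat-resp-≈ (∀' φ)   ρ≈ρ′ sat x′        =
  let x , ≈′ = extend-≈ (≈-sym ρ≈ρ′) x′ in Sat-resp-≈ φ (≈-sym ≈′) (sat x)

funToFin-cong : {f g : Fin m → Fin n} → (∀ i → f i ≡ g i) → funToFin f ≡ funToFin g
funToFin-cong {zero}  f≗g = refl
funToFin-cong {suc m} f≗g = cong₂ combine (f≗g zero) (funToFin-cong (f≗g ∘ suc))

code : (Fin m → Bool) → Fin (2 ^ m)
code x = funToFin (Inverse.from 2↔Bool ∘ x)

decode : Fin (2 ^ m) → Fin m → Bool
decode c = Inverse.to 2↔Bool ∘ finToFun c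

decode-code : (x : Fin m → Bool) → ∀ i → decode (code x) i ≡ x i
decode-code x i = trans (cong (Inverse.to 2↔Bool) (finToFun-funToFin _ i)) (Inverse.strictlyInverseˡ 2↔Bool (x i))

code-cong : {x y : Fin m → Bool} → (∀ i → x i ≡ y i) → code x ≡ code y
code-cong x≗y = funToFin-cong (cong (Inverse.from 2↔Bool) ∘ x≗y)

code-injective : {x y : Fin m → Bool} → code x ≡ code y → ∀ i → x i ≡ y i
code-injective {x = x} {y} eq i = trans (sym (decode-code x i)) (trans (cong (λ c → decode c i) eq) (decode-code y i))

sideGraph : {k : ℕ} → (Fin n → Vector (Fin m) k) → Fin k ⊎ Fin k → Fin k ⊎ Fin k → Fin n → Fin n → Bool
sideGraph ℓ s s′ u v = does ([ ℓ u , ℓ v ]′ s ≟ [ ℓ u , ℓ v ]′ s′)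

sideGraph-dichotomic : {k : ℕ} (ℓ : Fin n → Vector (Fin m) k) →
                       ∀ s s′ → Dichotomic (mkGraph n (sideGraph ℓ s s′))
sideGraph-dichotomic ℓ (inj₁ i) (inj₁ j) =
  matching⇒dichotomic Bool._≟_ _ (λ u → does (ℓ u i ≟ ℓ u j)) (const true) λ _ _ → ⇔.refl
sideGraph-dichotomic ℓ (inj₁ i) (inj₂ j) =
  matching⇒dichotomic _≟_ _ (λ u → ℓ u i) (λ v → ℓ v j) λ u v → does≡true⇔ (ℓ u i ≟ ℓ v j)
sideGraph-dichotomic ℓ (inj₂ i) (inj₁ j) =
  matching⇒dichotomic _≟_ _ (λ u → ℓ u j) (λ v → ℓ v i) λ u v →
    ⇔.trans (does≡true⇔ (ℓ v i ≟ ℓ u j)) (mk⇔ sym sym)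
sideGraph-dichotomic ℓ (inj₂ i) (inj₂ j) =
  matching⇒dichotomic Bool._≟_ _ (const true) (λ v → does (ℓ v i ≟ ℓ v j)) λ _ _ → mk⇔ sym sym

module Reduction {k : ℕ} (φ : Formula (k + k)) where

  P : ℕ
  P = (k + k) * (k + k)

  -- The first P arguments carry the equality type of the labels of (u , v);
  -- its code selects, among the remaining 2 ^ P arguments, the bit telling
  -- whether that equality type occurs on an edge.
  select : BoolFun (P + 2 ^ P)
  select x = x (P ↑ʳ code λ t → x (t ↑ˡ 2 ^ P))

  module _ {N : ℕ} (G : Graph) (rep : Represents N k φ G) where

    open Σ rep renaming (proj₁ to ℓ; proj₂ to represents)

    ρ : Fin (size G) → Fin (size G) → Fin (k + k) → Fin (suc N)
    ρ u v = _++_ {m = k} (ℓ u) (ℓ v)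

    eqBit : Fin (size G) → Fin (size G) → Fin (k + k) × Fin (k + k) → Bool
    eqBit u v (a , b) = does (ρ u v a ≟ ρ u v b)

    eqType : Fin (size G) → Fin (size G) → Fin P → Bool
    eqType u v = eqBit u v ∘ remQuot (k + k)

    eqType-≈ : ∀ {u v u′ v′} → (∀ t → eqType u v t ≡ eqType u′ v′ t) → ρ u v ≈ ρ u′ v′
    eqType-≈ {u} {v} {u′} {v′} same i j =
      does-≡⇒⇔ (ρ u v i ≟ ρ u v j) (ρ u′ v′ i ≟ ρ u′ v′ j) same-at-ij
      where
      same-at-ij : eqBit u v (i , j) ≡ eqBit u′ v′ (i , j)
      same-at-ij = subst (λ ij → eqBit u v ij ≡ eqBit u′ v′ ij) (remQuot-combine i j) (same (combine i j))

    Occurs : Fin (2 ^ P) → Set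
    Occurs c = ∃[ u ] ∃[ v ] (code (eqType u v) ≡ c × E G u v ≡ true)

    occurs? : ∀ c → Dec (Occurs c)
    occurs? c = any? λ u → any? λ v → (code (eqType u v) ≟ c) ×-dec (E G u v Bool.≟ true)

    occurs : Fin (2 ^ P) → Bool
    occurs c = does (occurs? c)

    edge≡occurs : ∀ u v → E G u v ≡ occurs (code (eqType u v))
    edge≡occurs u v = ⇔→≡ (mk⇔ edge⇒occurs occurs⇒edge)
      where
      edge⇒occurs : E G u v ≡ true → occurs (code (eqType u v)) ≡ true
      edge⇒occurs uv = dec-true (occurs? _) (u , v , refl , uv)

      occurs⇒edge : occurs (code (eqType u v)) ≡ true → E G u v ≡ true
      occurs⇒edge occ =
        let u′ , v′ , same-code , u′v′ = to (does≡true⇔ (occurs? _)) occ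
            ≈uv = eqType-≈ (code-injective same-code)
        in from (represents u v) (Sat-resp-≈ φ ≈uv (to (represents u′ v′) u′v′))

    layer : Fin P ⊎ Fin (2 ^ P) → Fin (size G) → Fin (size G) → Bool
    layer (inj₁ t) u v = eqType u v t
    layer (inj₂ c) u v = occurs c

    layer-dichotomic : ∀ s → Dichotomic (mkGraph (size G) (layer s))
    layer-dichotomic (inj₁ t) = let a , b = remQuot (k + k) t in sideGraph-dichotomic ℓ (splitAt k a) (splitAt k b)
    layer-dichotomic (inj₂ c) = constant-dichotomic (size G) (occurs c)

    H : Fin (P + 2 ^ P) → Fin (size G) → Fin (size G) → Bool
    H = layer ∘ splitAt P

    select-H : ∀ u v → select (λ i → H i u v) ≡ occurs (code (eqType u v))
    select-H u v = begin
      H (P ↑ʳ code (λ t → H (t ↑ˡ 2 ^ P) u v)) u v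
        ≡⟨ cong (λ c → H (P ↑ʳ c) u v) (code-cong λ t → cong (λ s → layer s u v) (splitAt-↑ˡ P t (2 ^ P))) ⟩
      H (P ↑ʳ code (eqType u v)) u v
        ≡⟨ cong (λ s → layer s u v) (splitAt-↑ʳ P (2 ^ P) _) ⟩
      occurs (code (eqType u v)) ∎
      where open ≡-Reasoning

    combination : BFComb (P + 2 ^ P) select Dichotomic G
    combination = H , layer-dichotomic ∘ splitAt P , λ u v _ → trans (edge≡occurs u v) (sym (select-H u v))

GFO⇒≤BF-dichotomic : (C : Class) → GFO C → C ≤BF Dichotomic
GFO⇒≤BF-dichotomic C (k , φ , c , C⊆gr) =
  _ , Reduction.select {k} φ , λ G CG → Reduction.combination {k} φ G (C⊆gr G CG)

theorem6p17 : GFO Dichotomic × (∀ (C : Class) → IsoClosed C → GFO C → C ≤BF Dichotomic)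
theorem6p17 = dichotomic∈GFO , λ C _ → GFO⇒≤BF-dichotomic C
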